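{- For all $\varphi,\psi\in Sen(L_s)$, $$\varphi\wedge\psi\models_s\varphi|\psi \quad\text{and}\quad \varphi|\psi\models_s\varphi\vee\psi .$$ Moreover, these cannot be reversed in general: there exist $\varphi,\psi\in Sen(L_s)$ with $\varphi\vee\psi\not\models_s\varphi|\psi$, and there exist $\varphi,\psi\in Sen(L_s)$ with $\varphi|\psi\not\models_s\varphi\wedge\psi$.
   Context: Let $L$ be the propositional language with atomic sentences $p_0,p_1,\ldots$ and connectives $\neg,\wedge$ (with $\vee,\rightarrow,\leftrightarrow$ defined from them as usual); $Sen(L)$ is its set of sentences. $L_s$ is $L$ extended by a new primitive binary connective $|$; $Sen(L_s)$ is the set of sentences built from the atoms using $\neg,\wedge,|$. A truth assignment $M$ is a classical two-valued valuation of $Sen(L)$; $M\models\alpha$ means $\alpha$ is true under $M$. A choice function for $L$ is a map $f$ assigning to each set $\{\alpha,\beta\}$ with $\alpha,\beta\in Sen(L)$ (possibly $\alpha=\beta$) an element $f(\alpha,\beta)\in\{\alpha,\beta\}$; $\mathcal F$ is the set of all choice functions for $L$. Each $f$ induces $\overline f:Sen(L_s)\to Sen(L)$ by $\overline f(\alpha)=\alpha$ for $\alpha\in Sen(L)$, $\overline f(\varphi\wedge\psi)=\overline f(\varphi)\wedge\overline f(\psi)$, $\overline f(\neg\varphi)=\neg\overline f(\varphi)$, $\overline f(\varphi|\psi)=f(\overline f(\varphi),\overline f(\psi))$. Define $\langle M,f\rangle\models_s\varphi$ iff $M\models\overline f(\varphi)$. Then $\varphi\models_s\psi$ means: for every truth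 assignment $M$ and every $f\in\mathcal F$, $\langle M,f\rangle\models_s\varphi$ implies $\langle M,f\rangle\models_s\psi$. -}

module Defs where

open import Data.Nat using (ℕ)
open import Data.Bool using (Bool; true; false; not; _∧_)
open import Data.Sum using (_⊎_)
open import Data.Product using (_×_; Σ)
open import Relation.Binary.PropositionalEquality using (_≡_)

data Sen : Set where
  atom : ℕ → Sen
  ¬ₗ   : Sen → Sen
  _∧ₗ_ : Sen → Sen → Sen

data SenS : Set where
  atom : ℕ → SenS
  ¬ₛ   : SenS → SenS
  _∧ₛ_ : SenS → SenS → SenS
  _∣ₛ_ : SenS → SenS → SenS

_∨ₛ_ : SenS → SenS → SenS
φ ∨ₛ ψ = ¬ₛ (¬ₛ φ ∧ₛ ¬ₛ ψ)

Assignment : Set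
Assignment = ℕ → Bool

eval : Assignment → Sen → Bool
eval M (atom i) = M i
eval M (¬ₗ α)   = not (eval M α)
eval M (α ∧ₗ β) = eval M α ∧ eval M β

_⊨_ : Assignment → Sen → Set
M ⊨ α = eval M α ≡ true

-- A choice function: assigns to each unordered pair {α,β} an element of it.
-- Represented as a binary function that is symmetric (so it depends only on
-- the set {α,β}) and always returns one of its arguments.
record ChoiceFn : Set where
  field
    f      : Sen → Sen → Sen
    choose : ∀ α β → (f α β ≡ α) ⊎ (f α β ≡ β)
    sym    : ∀ α β → f α β ≡ f β α
open ChoiceFn public

bar : ChoiceFn → SenS → Sen
bar F (atom i) = atom i
bar F (¬ₛ φ)   = ¬ₗ (bar F φ)
bar F (φ ∧ₛ ψ) = bar F φ ∧ₗ bar F ψ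
bar F (φ ∣ₛ ψ) = f F (bar F φ) (bar F ψ)

_,_⊨ₛ_ : Assignment → ChoiceFn → SenS → Set
M , F ⊨ₛ φ = M ⊨ bar F φ

_⊨ₛ_ : SenS → SenS → Set
φ ⊨ₛ ψ = ∀ (M : Assignment) (F : ChoiceFn) → M , F ⊨ₛ φ → M , F ⊨ₛ ψ

-- The connective | picks one of its two arguments, so under any ⟨M, f⟩ the
-- value of φ | ψ is the value of φ or of ψ; it therefore lies between φ ∧ ψ
-- and φ ∨ ψ. For strictness take φ = p₀, ψ = p₁ and a choice function that
-- always picks p₀ from {p₀, p₁}: it makes p₀ | p₁ false when p₁ but not p₀ is true
-- and true when only p₀ is true. Such a choice function is obtained by taking
-- the lexicographically least Polish-notation code of the two sentences.
module Submission where

open import Defs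
open import Data.Bool using (true; false; not; _∧_)
open import Data.List using (List; []; _∷_; _++_)
open import Data.List.Properties using (++-assoc; ++-identityʳ; ∷-injectiveʳ)
open import Data.List.Relation.Binary.Pointwise using (Pointwise-≡⇒≡)
open import Data.List.Relation.Binary.Lex.NonStrict using (≤-decTotalOrder)
open import Data.Nat using (ℕ; zero; suc)
import Data.Nat.Properties as ℕ
open import Data.Product using (_×_; ∃₂; _,_; proj₁)
open import Data.Sum using (_⊎_; inj₁; inj₂; [_,_]′)
open import Function using (const)
open import Relation.Binary using (Rel; DecTotalOrder; Total; Antisymmetric)
open import Relation.Binary.PropositionalEquality
  using (_≡_; refl; trans) renaming (sym to ≡-sym)
open import Relation.Nullary using (¬_)

module _ {ℓ} {_≤_ : Rel Sen ℓ} (total : Total _≤_) (antisym : Antisymmetric _≡_ _≤_) where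

  minimum : Sen → Sen → Sen
  minimum α β = [ const α , const β ]′ (total α β)

  minimum-choose : ∀ α β → (minimum α β ≡ α) ⊎ (minimum α β ≡ β)
  minimum-choose α β with total α β
  ... | inj₁ _ = inj₁ refl
  ... | inj₂ _ = inj₂ refl

  minimum-sym : ∀ α β → minimum α β ≡ minimum β α
  minimum-sym α β with total α β | total β α
  ... | inj₁ α≤β | inj₁ β≤α = antisym α≤β β≤α
  ... | inj₁ _   | inj₂ _   = refl
  ... | inj₂ _   | inj₁ _   = refl
  ... | inj₂ β≤α | inj₂ α≤β = antisym β≤α α≤β

  minimumChoice : ChoiceFn
  minimumChoice = record { f = minimum ; choose = minimum-choose ; sym = minimum-sym }

code : Sen → List ℕ
code (atom i) = 0 ∷ i ∷ []
code (¬ₗ α)   = 1 ∷ code α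
code (α ∧ₗ β) = 2 ∷ code α ++ code β

code-++-injective : ∀ α β {xs ys} → code α ++ xs ≡ code β ++ ys → α ≡ β × xs ≡ ys
code-++-injective (atom i) (atom j) refl = refl , refl
code-++-injective (¬ₗ α) (¬ₗ β) eq with code-++-injective α β (∷-injectiveʳ eq)
... | refl , xs≡ys = refl , xs≡ys
code-++-injective (α ∧ₗ β) (γ ∧ₗ δ) {xs} {ys} eq
  with code-++-injective α γ (trans (≡-sym (++-assoc (code α) (code β) xs))
                                    (trans (∷-injectiveʳ eq) (++-assoc (code γ) (code δ) ys)))
... | refl , tails with code-++-injective β δ tails
... | refl , xs≡ys = refl , xs≡ys
code-++-injective (atom _) (¬ₗ _)   ()
code-++-injective (atom _) (_ ∧ₗ _) ()
code-++-injective (¬ₗ _)   (atom _) ()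
code-++-injective (¬ₗ _)   (_ ∧ₗ _) ()
code-++-injective (_ ∧ₗ _) (atom _) ()
code-++-injective (_ ∧ₗ _) (¬ₗ _)   ()

code-injective : ∀ {α β} → code α ≡ code β → α ≡ β
code-injective {α} {β} eq =
  proj₁ (code-++-injective α β (trans (++-identityʳ (code α)) (trans eq (≡-sym (++-identityʳ (code β))))))

module Lex = DecTotalOrder (≤-decTotalOrder ℕ.≤-decTotalOrder)

_≼_ : Rel Sen _
α ≼ β = code α Lex.≤ code β

≼-total : Total _≼_
≼-total α β = Lex.total (code α) (code β)

≼-antisym : Antisymmetric _≡_ _≼_
≼-antisym α≼β β≼α = code-injective (Pointwise-≡⇒≡ (Lex.antisym α≼β β≼α))

lexChoice : ChoiceFn
lexChoice = minimumChoice ≼-total ≼-antisym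

∧-true : ∀ {x y} → x ∧ y ≡ true → (x ≡ true) × (y ≡ true)
∧-true {true} {true} _ = refl , refl

∨-true : ∀ {x y} → (x ≡ true) ⊎ (y ≡ true) → not (not x ∧ not y) ≡ true
∨-true {true}         _        = refl
∨-true {false} {true} (inj₂ _) = refl

∧-entails-∣ : ∀ φ ψ → (φ ∧ₛ ψ) ⊨ₛ (φ ∣ₛ ψ)
∧-entails-∣ φ ψ M F h with choose F (bar F φ) (bar F ψ) | ∧-true h
... | inj₁ e | ⊨φ , _  rewrite e = ⊨φ
... | inj₂ e | _  , ⊨ψ rewrite e = ⊨ψ

∣-entails-∨ : ∀ φ ψ → (φ ∣ₛ ψ) ⊨ₛ (φ ∨ₛ ψ)
∣-entails-∨ φ ψ M F h with choose F (bar F φ) (bar F ψ)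
... | inj₁ e rewrite e = ∨-true (inj₁ h)
... | inj₂ e rewrite e = ∨-true (inj₂ h)

allButP₀ : Assignment
allButP₀ zero    = false
allButP₀ (suc _) = true

onlyP₀ : Assignment
onlyP₀ zero    = true
onlyP₀ (suc _) = false

theorem2p8 : ((φ ψ : SenS) → ((φ ∧ₛ ψ) ⊨ₛ (φ ∣ₛ ψ)) × ((φ ∣ₛ ψ) ⊨ₛ (φ ∨ₛ ψ)))
    × (∃₂ λ (φ ψ : SenS) → ¬ ((φ ∨ₛ ψ) ⊨ₛ (φ ∣ₛ ψ)))
    × (∃₂ λ (φ ψ : SenS) → ¬ ((φ ∣ₛ ψ) ⊨ₛ (φ ∧ₛ ψ)))
theorem2p8 =
    (λ φ ψ → ∧-entails-∣ φ ψ , ∣-entails-∨ φ ψ)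
  , (atom 0 , atom 1 , λ entails → false≢true (entails allButP₀ lexChoice refl))
  , (atom 0 , atom 1 , λ entails → false≢true (entails onlyP₀ lexChoice refl))
  where
  false≢true : ¬ (false ≡ true)
  false≢true ()
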